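{- Let $r\in\mathbb{N}$, $m_1,\ldots,m_r\in\mathbb{N}$, $m=\operatorname{lcm}[m_1,\ldots,m_r]$, and $M\in\mathbb{N}$ with $m\mid M$. Let $f_1,\ldots,f_r:\mathbb{N}\to\mathbb{C}$ be arbitrary arithmetical functions and $G=(g_1,\ldots,g_r)$ a system of polynomials with integer coefficients. Then \[ \frac{1}{M}\sum_{k=1}^{M} f_1(\gcd(g_1(k),m_1))\cdots f_r(\gcd(g_r(k),m_r)) =\sum_{d_1\mid m_1,\ldots,d_r\mid m_r}\frac{(\mu*f_1)(d_1)\cdots(\mu*f_r)(d_r)}{\operatorname{lcm}[d_1,\ldots,d_r]}\,N_G(d_1,\ldots,d_r); \] in particular the left-hand side does not depend on the choice of $M$.
   Context: $\mathbb{N}=\{1,2,\ldots\}$. $\mu$ is the Möbius function and $(f*g)(n)=\sum_{d\mid n}f(d)g(n/d)$ the Dirichlet convolution. For a system $G=(g_1,\ldots,g_r)$ of integer polynomials and $d_1,\ldots,d_r\in\mathbb{N}$, $N_G(d_1,\ldots,d_r)$ is the number of residues $x$ modulo $\operatorname{lcm}[d_1,\ldots,d_r]$ such that $g_i(x)\equiv 0\pmod{d_i}$ for all $1\le i\le r$. (Here $\gcd(0,m_i)=m_i$.) -}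

module Defs where

open import Data.Nat using (ℕ; zero; suc; _/_)
import Data.Nat as N
open import Data.Nat.Divisibility using (_∣?_)
open import Data.Nat.GCD using (gcd)
open import Data.Nat.LCM using (lcm)
open import Data.Nat.Primality using (prime?)
open import Data.Integer as ℤ using (ℤ; +_; ∣_∣)
open import Data.Bool using (Bool; true; false; not; _∧_; if_then_else_)
open import Data.List using (List; []; _∷_; length; upTo; map; foldr)
open import Data.Fin using (Fin)
import Data.Fin as Fin
open import Data.Vec.Functional using (head; tail)
import Data.Vec.Functional as VF
open import Relation.Nullary.Decidable using (⌊_⌋)
open import Algebra.Bundles using (CommutativeRing)
open import Level using (Level)

filterB : {A : Set} → (A → Bool) → List A → List A
filterB p [] = []
filterB p (x ∷ xs) = if p x then x ∷ filterB p xs else filterB p xs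

-- Integer polynomials, coefficient list with the constant term first.
Poly : Set
Poly = List ℤ

eval : Poly → ℤ → ℤ
eval [] x = + 0
eval (a ∷ as) x = a ℤ.+ x ℤ.* eval as x

lcmF : (r : ℕ) → (Fin r → ℕ) → ℕ
lcmF zero d = 1
lcmF (suc r) d = lcm (head d) (lcmF r (tail d))

allFinB : (r : ℕ) → (Fin r → Bool) → Bool
allFinB zero b = true
allFinB (suc r) b = head b ∧ allFinB r (tail b)

NG : (r : ℕ) → (Fin r → Poly) → (Fin r → ℕ) → ℕ
NG r g d = length (filterB (λ x → allFinB r (λ i → ⌊ d i ∣? ∣ eval (g i) (+ x) ∣ ⌋))
                          (upTo (lcmF r d)))

allB : {A : Set} → (A → Bool) → List A → Bool
allB p [] = true
allB p (x ∷ xs) = p x ∧ allB p xs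

squarefreeB : ℕ → Bool
squarefreeB n = allB (λ j → not ⌊ (suc (suc j) N.* suc (suc j)) ∣? n ⌋) (upTo n)

ω : ℕ → ℕ
ω n = length (filterB (λ p → ⌊ prime? p ⌋ ∧ ⌊ p ∣? n ⌋) (upTo (suc n)))

data MuVal : Set where
  μzero μone μminus : MuVal

parityVal : ℕ → MuVal
parityVal zero = μone
parityVal (suc zero) = μminus
parityVal (suc (suc k)) = parityVal k

μ : ℕ → MuVal
μ n = if squarefreeB n then parityVal (ω n) else μzero

-- integer division, with the (unused) convention quot M 0 = 0
quot : ℕ → ℕ → ℕ
quot M zero = 0
quot M (suc l) = M / suc l

module InRing {c ℓ : Level} (R : CommutativeRing c ℓ) where
  open CommutativeRing R

  μR : ℕ → Carrier
  μR n with μ n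
  ... | μzero = 0#
  ... | μone = 1#
  ... | μminus = - 1#

  natR : ℕ → Carrier
  natR zero = 0#
  natR (suc n) = 1# + natR n

  sumL : List Carrier → Carrier
  sumL = foldr _+_ 0#

  sumFrom1 : ℕ → (ℕ → Carrier) → Carrier
  sumFrom1 n F = sumL (map (λ j → F (suc j)) (upTo n))

  sumDiv : ℕ → (ℕ → Carrier) → Carrier
  sumDiv n F = sumL (map F (filterB (λ d → ⌊ d ∣? n ⌋) (map suc (upTo n))))

  μconv : (ℕ → Carrier) → ℕ → Carrier
  μconv f n = sumDiv n (λ d → μR d * f (quot n d))

  prodF : (r : ℕ) → (Fin r → Carrier) → Carrier
  prodF zero a = 1#
  prodF (suc r) a = head a * prodF r (tail a)

  sumDivTuples : (r : ℕ) → (Fin r → ℕ) → ((Fin r → ℕ) → Carrier) → Carrier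
  sumDivTuples zero m F = F (λ ())
  sumDivTuples (suc r) m F =
    sumDiv (head m) (λ d → sumDivTuples r (tail m) (λ ds → F (d VF.∷ ds)))

module Submission where

-- theorem1 is the paper's identity multiplied through by M:
--   Σ_{k=1}^{M} ∏ᵢ fᵢ(gcd(gᵢ(k), mᵢ))
--     = Σ_{d₁∣m₁,…,d_r∣m_r} ∏ᵢ (μ * fᵢ)(dᵢ) · (M / lcm[d]) · N_G(d).
--
-- Möbius inversion gives f(gcd(a, m)) = Σ_{d ∣ m} [d ∣ a]·(μ * f)(d).  Applying
-- this to every factor and multiplying out, the k-th summand becomes a sum over
-- tuples d of ∏ᵢ (μ * fᵢ)(dᵢ)·[dᵢ ∣ gᵢ(k) for all i].  Exchanging the sums over
-- k and over d, it remains to count the k ∈ {1,…,M} solving dᵢ ∣ gᵢ(k) for all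
-- i.  Since g(x + L) ≡ g(x) (mod L) for integer polynomials, this condition is
-- periodic modulo L = lcm[d] ∣ M, so the count is (M/L)·N_G(d).

open import Defs
open import Data.Nat using (ℕ; _≤_)
open import Data.Nat.Divisibility using (_∣_)
import Data.Nat as N
open import Data.Nat.GCD using (gcd)
open import Data.Integer using (+_; ∣_∣)
open import Data.Fin using (Fin)
open import Algebra.Bundles using (CommutativeRing)
open import Level using (Level)
open import Data.Nat.Divisibility using (_∣?_; ∣-trans)
open import Relation.Nullary.Decidable using (⌊_⌋)
import Relation.Binary.Reasoning.Setoid as SetoidReasoning

module Reflection where
  open import Data.Bool using (Bool; true; false)
  open import Relation.Nullary using (¬_; Dec; yes; no)
  open import Relation.Nullary.Decidable using (⌊_⌋)
  open import Relation.Binary.PropositionalEquality using (_≡_; refl)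
  open import Data.Empty using (⊥-elim)

  ⌊⌋-true : ∀ {a} {A : Set a} (a? : Dec A) → A → ⌊ a? ⌋ ≡ true
  ⌊⌋-true (yes _) _ = refl
  ⌊⌋-true (no ¬a) a = ⊥-elim (¬a a)

  ⌊⌋-false : ∀ {a} {A : Set a} (a? : Dec A) → ¬ A → ⌊ a? ⌋ ≡ false
  ⌊⌋-false (yes a) ¬a = ⊥-elim (¬a a)
  ⌊⌋-false (no _) _ = refl

  ⌊⌋-⇔ : ∀ {a b} {A : Set a} {B : Set b} (a? : Dec A) (b? : Dec B) →
         (A → B) → (B → A) → ⌊ a? ⌋ ≡ ⌊ b? ⌋
  ⌊⌋-⇔ (yes _) (yes _) _ _ = refl
  ⌊⌋-⇔ (yes a) (no ¬b) f _ = ⊥-elim (¬b (f a))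
  ⌊⌋-⇔ (no ¬a) (yes b) _ g = ⊥-elim (¬a (g b))
  ⌊⌋-⇔ (no _) (no _) _ _ = refl

  bool-⇔ : ∀ a b → (a ≡ true → b ≡ true) → (b ≡ true → a ≡ true) → a ≡ b
  bool-⇔ true true _ _ = refl
  bool-⇔ true false f _ with f refl
  ... | ()
  bool-⇔ false true _ g with g refl
  ... | ()
  bool-⇔ false false _ _ = refl

open Reflection

module Counting where
  open import Data.Nat using (ℕ; zero; suc; _+_; _*_; _/_; _≤_; _<_; z≤n; _≟_)
  open import Data.Nat.Properties
  open import Data.Nat.Divisibility using (_∣_; 0∣⇒≡0)
  open import Data.Nat.DivMod using (m/n*n≡m)
  open import Data.Empty using (⊥-elim)
  open import Data.Bool using (Bool; true; false; _∧_; _∨_)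
  open import Data.List using ([]; _∷_; _++_; length; upTo)
  open import Data.List.Properties using (upTo-∷ʳ; length-++)
  open import Data.Sum using (inj₁; inj₂)
  open import Relation.Nullary.Decidable using (⌊_⌋)
  open import Relation.Binary.PropositionalEquality
  open import Algebra.Properties.CommutativeSemigroup +-commutativeSemigroup using (interchange)
  open ≡-Reasoning

  bit : Bool → ℕ
  bit true = 1
  bit false = 0

  count : ℕ → (ℕ → Bool) → ℕ
  count zero B = 0
  count (suc n) B = count n B + bit (B n)

  filterB-++ : ∀ {A : Set} (B : A → Bool) xs ys →
               filterB B (xs ++ ys) ≡ filterB B xs ++ filterB B ys
  filterB-++ B [] ys = refl
  filterB-++ B (x ∷ xs) ys with B x
  ... | true = cong (x ∷_) (filterB-++ B xs ys)
  ... | false = filterB-++ B xs ys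

  length-filterB-single : ∀ {A : Set} (B : A → Bool) x → length (filterB B (x ∷ [])) ≡ bit (B x)
  length-filterB-single B x with B x
  ... | true = refl
  ... | false = refl

  length-filterB-upTo : ∀ B n → length (filterB B (upTo n)) ≡ count n B
  length-filterB-upTo B zero = refl
  length-filterB-upTo B (suc n) = begin
    length (filterB B (upTo (suc n)))           ≡⟨ cong (λ xs → length (filterB B xs)) (sym (upTo-∷ʳ n)) ⟩
    length (filterB B (upTo n ++ n ∷ []))        ≡⟨ cong length (filterB-++ B (upTo n) (n ∷ [])) ⟩
    length (filterB B (upTo n) ++ filterB B (n ∷ [])) ≡⟨ length-++ (filterB B (upTo n)) ⟩
    length (filterB B (upTo n)) + length (filterB B (n ∷ []))
      ≡⟨ cong₂ _+_ (length-filterB-upTo B n) (length-filterB-single B n) ⟩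
    count n B + bit (B n) ∎

  count-cong : ∀ n {B C : ℕ → Bool} → (∀ j → j < n → B j ≡ C j) → count n B ≡ count n C
  count-cong zero h = refl
  count-cong (suc n) h = cong₂ _+_ (count-cong n (λ j j<n → h j (m≤n⇒m≤1+n j<n)))
                                   (cong bit (h n ≤-refl))

  count-extend : ∀ {n} N B → n ≤ N → (∀ j → n ≤ j → j < N → B j ≡ false) →
                 count N B ≡ count n B
  count-extend zero B z≤n _ = refl
  count-extend (suc N) B n≤1+N h with m≤n⇒m<n∨m≡n n≤1+N
  ... | inj₂ refl = refl
  ... | inj₁ n<1+N = begin
    count N B + bit (B N) ≡⟨ cong (λ b → count N B + bit b) (h N (≤-pred n<1+N) ≤-refl) ⟩
    count N B + 0         ≡⟨ +-identityʳ (count N B) ⟩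
    count N B             ≡⟨ count-extend N B (≤-pred n<1+N) (λ j n≤j j<N → h j n≤j (m≤n⇒m≤1+n j<N)) ⟩
    _ ∎

  count-false : ∀ n B → (∀ j → j < n → B j ≡ false) → count n B ≡ 0
  count-false n B h = count-extend n B z≤n (λ j _ j<n → h j j<n)

  count-∨ : ∀ n B C → (∀ j → B j ∧ C j ≡ false) →
            count n (λ j → B j ∨ C j) ≡ count n B + count n C
  count-∨ zero B C _ = refl
  count-∨ (suc n) B C disjoint = begin
    count n (λ j → B j ∨ C j) + bit (B n ∨ C n)
      ≡⟨ cong₂ _+_ (count-∨ n B C disjoint) (bit-∨ (B n) (C n) (disjoint n)) ⟩
    (count n B + count n C) + (bit (B n) + bit (C n))
      ≡⟨ interchange (count n B) (count n C) (bit (B n)) (bit (C n)) ⟩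
    count (suc n) B + count (suc n) C ∎
    where
    bit-∨ : ∀ a b → a ∧ b ≡ false → bit (a ∨ b) ≡ bit a + bit b
    bit-∨ true false _ = refl
    bit-∨ false b _ = refl

  count-point : ∀ {p} n → p < n → count n (λ j → ⌊ j ≟ p ⌋) ≡ 1
  count-point {p} n p<n = begin
    count n P       ≡⟨ count-extend n P p<n (λ j p<j _ → ⌊⌋-false (j ≟ p) (λ j≡p → <-irrefl (sym j≡p) p<j)) ⟩
    count p P + bit (P p) ≡⟨ cong₂ _+_ (count-false p P (λ j j<p → ⌊⌋-false (j ≟ p) (λ j≡p → <-irrefl j≡p j<p)))
                                      (cong bit (⌊⌋-true (p ≟ p) refl)) ⟩
    1 ∎
    where P = λ j → ⌊ j ≟ p ⌋

  count-shift : ∀ n B → count n (λ j → B (suc j)) + bit (B 0) ≡ count n B + bit (B n)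
  count-shift zero B = refl
  count-shift (suc n) B = begin
    count n B′ + bit (B (suc n)) + bit (B 0) ≡⟨ +-assoc (count n B′) _ _ ⟩
    count n B′ + (bit (B (suc n)) + bit (B 0)) ≡⟨ cong (λ x → count n B′ + x) (+-comm (bit (B (suc n))) _) ⟩
    count n B′ + (bit (B 0) + bit (B (suc n))) ≡⟨ +-assoc (count n B′) _ _ ⟨
    count n B′ + bit (B 0) + bit (B (suc n))   ≡⟨ cong (_+ bit (B (suc n))) (count-shift n B) ⟩
    count n B + bit (B n) + bit (B (suc n)) ∎
    where B′ = λ j → B (suc j)

  count-split : ∀ a b B → count (a + b) B ≡ count a B + count b (λ j → B (a + j))
  count-split a zero B rewrite +-identityʳ a = sym (+-identityʳ (count a B))
  count-split a (suc b) B rewrite +-suc a b | count-split a b B = +-assoc (count a B) _ _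

  Periodic : (ℕ → Bool) → ℕ → Set
  Periodic B L = ∀ x → B (x + L) ≡ B x

  count-periodic : ∀ q L B → Periodic B L → count (q * L) B ≡ q * count L B
  count-periodic zero L B per = refl
  count-periodic (suc q) L B per = begin
    count (L + q * L) B                        ≡⟨ count-split L (q * L) B ⟩
    count L B + count (q * L) (λ j → B (L + j)) ≡⟨ cong (λ x → count L B + x) (count-cong (q * L) shifted) ⟩
    count L B + count (q * L) B                ≡⟨ cong (λ x → count L B + x) (count-periodic q L B per) ⟩
    count L B + q * count L B ∎
    where
    shifted : ∀ j → j < q * L → B (L + j) ≡ B j
    shifted j _ = trans (cong B (+-comm L j)) (per j)

  periodic-multiple : ∀ q L B → Periodic B L → B (q * L) ≡ B 0
  periodic-multiple zero L B per = refl
  periodic-multiple (suc q) L B per =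
    trans (cong B (+-comm L (q * L))) (trans (per (q * L)) (periodic-multiple q L B per))

  count-from-1-periodic : ∀ M L B → 1 ≤ M → L ∣ M → Periodic B L →
                          count M (λ j → B (suc j)) ≡ quot M L * count L B
  count-from-1-periodic M zero B M≥1 0∣M _ = ⊥-elim (<-irrefl (sym (0∣⇒≡0 0∣M)) M≥1)
  count-from-1-periodic M L@(suc l) B M≥1 L∣M per = begin
    count M (λ j → B (suc j)) ≡⟨ +-cancelʳ-≡ (bit (B 0)) _ _ (trans (count-shift M B) (cong (λ b → count M B + bit b) BM≡B0)) ⟩
    count M B                 ≡⟨ cong (λ n → count n B) (sym (m/n*n≡m L∣M)) ⟩
    count (M / L * L) B       ≡⟨ count-periodic (M / L) L B per ⟩
    M / L * count L B ∎
    where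
    BM≡B0 : B M ≡ B 0
    BM≡B0 = trans (cong B (sym (m/n*n≡m L∣M))) (periodic-multiple (M / L) L B per)

open Counting

module MoebiusStep where
  open import Data.Nat using (ℕ; zero; suc; _+_; _*_; _≤_; _<_; z≤n; s≤s; _≟_; NonZero; >-nonZero)
  open import Data.Nat.Properties
  open import Data.Nat.Divisibility
  open import Data.Nat.Coprimality using (Coprime; coprime-divisor)
  open import Data.Nat.Primality using (Prime; prime?; prime⇒irreducible; euclidsLemma; ¬prime[1])
  open import Data.Bool using (Bool; true; false; not; _∧_; _∨_)
  open import Data.List using ([]; _∷_; upTo)
  open import Data.List.Membership.Propositional using (_∈_)
  open import Data.List.Membership.Propositional.Properties using (∈-upTo⁺)
  open import Data.List.Relation.Unary.Any using (here; there)
  open import Data.Sum using (_⊎_; inj₁; inj₂)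
  open import Data.Product using (∃; _×_; _,_)
  open import Data.Nat.Primality.Factorisation using (factorise)
  open import Data.Nat.ListAction using (product)
  open import Data.List.Relation.Unary.All using (_∷_)
  open import Data.Empty using (⊥-elim)
  open import Relation.Nullary using (¬_; yes; no)
  open import Relation.Nullary.Decidable using (⌊_⌋)
  open import Relation.Binary.PropositionalEquality
  open ≡-Reasoning

  prime≥2 : ∀ {p} → Prime p → 2 ≤ p
  prime≥2 {suc (suc _)} _ = s≤s (s≤s z≤n)
  prime≥2 {zero} ()
  prime≥2 {suc zero} ()

  prime-factor : ∀ n → 2 ≤ n → ∃ λ p → Prime p × p ∣ n
  prime-factor n@(suc (suc _)) (s≤s (s≤s z≤n)) with factorise n
  ... | record { factors = [] ; isFactorisation = () }
  ... | record { factors = p ∷ ps ; isFactorisation = n≡∏ ; factorsPrime = pp ∷ _ } =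
    p , pp , subst (p ∣_) (sym n≡∏) (m∣m*n (product ps))

  prime-coprime : ∀ {p k} → Prime p → ¬ p ∣ k → Coprime k p
  prime-coprime pp p∤k (i∣k , i∣p) with prime⇒irreducible pp i∣p
  ... | inj₁ i≡1 = i≡1
  ... | inj₂ refl = ⊥-elim (p∤k i∣k)

  prime-∣-mul : ∀ {p q} c → Prime p → Prime q → q ∣ p * c → q ∣ c ⊎ q ≡ p
  prime-∣-mul {p} c pp pq q∣pc with euclidsLemma p c pq q∣pc
  ... | inj₂ q∣c = inj₁ q∣c
  ... | inj₁ q∣p with prime⇒irreducible pp q∣p
  ...   | inj₁ refl = ⊥-elim (¬prime[1] pq)
  ...   | inj₂ q≡p = inj₂ q≡p

  allB-true : ∀ {A : Set} {P : A → Bool} {x} xs → allB P xs ≡ true → x ∈ xs → P x ≡ true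
  allB-true {P = P} (y ∷ ys) h (here refl) with P y
  ... | true = refl
  allB-true {P = P} (y ∷ ys) h (there x∈ys) with P y
  ... | true = allB-true ys h x∈ys

  allB-intro : ∀ {A : Set} {P : A → Bool} xs → (∀ x → x ∈ xs → P x ≡ true) → allB P xs ≡ true
  allB-intro [] _ = refl
  allB-intro (y ∷ ys) h rewrite h y (here refl) = allB-intro ys (λ x x∈ys → h x (there x∈ys))

  SquareFree : ℕ → Set
  SquareFree n = ∀ k → 2 ≤ k → ¬ (k * k ∣ n)

  squarefreeB-sound : ∀ {n} → 1 ≤ n → squarefreeB n ≡ true → SquareFree n
  squarefreeB-sound {n} n≥1 h (suc (suc j)) (s≤s (s≤s z≤n)) kk∣n =
    false≢true (subst (λ b → not b ≡ true) (⌊⌋-true (k * k ∣? n) kk∣n)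
                      (allB-true (upTo n) h (∈-upTo⁺ j<n)))
    where
    k = suc (suc j)
    false≢true : ¬ (false ≡ true)
    false≢true ()
    j<n : j < n
    j<n = ≤-trans (n≤1+n (suc j)) (≤-trans (m≤m*n k k) (∣⇒≤ {{>-nonZero n≥1}} kk∣n))

  squarefreeB-complete : ∀ {n} → SquareFree n → squarefreeB n ≡ true
  squarefreeB-complete {n} sf = allB-intro (upTo n) λ j _ →
    cong not (⌊⌋-false _ (sf (suc (suc j)) (s≤s (s≤s z≤n))))

  square-coprime-cancel : ∀ {k p c} .{{_ : NonZero k}} → Coprime k p → k * k ∣ p * c → k * k ∣ c
  square-coprime-cancel {k} {p} {c} cop kk∣pc with coprime-divisor cop (∣-trans (m∣m*n k) kk∣pc)
  ... | divides c′ refl = *-pres-∣ k∣c′ (∣-refl {k})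
    where
    k∣pc′ : k ∣ p * c′
    k∣pc′ = *-cancelʳ-∣ k (subst (k * k ∣_) (sym (*-assoc p c′ k)) kk∣pc)
    k∣c′ : k ∣ c′
    k∣c′ = coprime-divisor cop k∣pc′

  squarefree-divisor : ∀ {d n} → d ∣ n → SquareFree n → SquareFree d
  squarefree-divisor d∣n sf k k≥2 kk∣d = sf k k≥2 (∣-trans kk∣d d∣n)

  squarefree-mul-prime : ∀ {p c} → Prime p → ¬ p ∣ c → SquareFree c → SquareFree (p * c)
  squarefree-mul-prime {p} {c} pp p∤c sf k k≥2 kk∣pc with p ∣? k
  ... | yes p∣k = p∤c (*-cancelˡ-∣ p (∣-trans (*-pres-∣ p∣k p∣k) kk∣pc))
    where instance _ = >-nonZero (≤-trans (s≤s z≤n) (prime≥2 pp))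
  ... | no p∤k = sf k k≥2 (square-coprime-cancel (prime-coprime pp p∤k) kk∣pc)
    where instance _ = >-nonZero (≤-trans (s≤s z≤n) k≥2)

  not-squarefree : ∀ {p c} → Prime p → p ∣ c → ¬ SquareFree (p * c)
  not-squarefree {p} pp p∣c sf = sf p (prime≥2 pp) (*-pres-∣ (∣-refl {p}) p∣c)

  primeDivisor : ℕ → ℕ → Bool
  primeDivisor n q = ⌊ prime? q ⌋ ∧ ⌊ q ∣? n ⌋

  primeDivisor-mul : ∀ {p c} q → Prime p → ¬ p ∣ c →
                     primeDivisor (p * c) q ≡ primeDivisor c q ∨ ⌊ q ≟ p ⌋
  primeDivisor-mul {p} {c} q pp p∤c with prime? q
  ... | no ¬pq = sym (⌊⌋-false (q ≟ p) λ { refl → ¬pq pp })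
  ... | yes pq with q ∣? c | q ≟ p
  ...   | yes q∣c | _ = ⌊⌋-true (q ∣? p * c) (∣n⇒∣m*n p q∣c)
  ...   | no _ | yes refl = ⌊⌋-true (q ∣? p * c) (m∣m*n c)
  ...   | no q∤c | no q≢p = ⌊⌋-false (q ∣? p * c) only-c-or-p
    where
    only-c-or-p : ¬ q ∣ p * c
    only-c-or-p q∣pc with prime-∣-mul c pp pq q∣pc
    ... | inj₁ q∣c = q∤c q∣c
    ... | inj₂ q≡p = q≢p q≡p

  primeDivisor-disjoint : ∀ {p c} q → ¬ p ∣ c → primeDivisor c q ∧ ⌊ q ≟ p ⌋ ≡ false
  primeDivisor-disjoint {p} {c} q p∤c with q ≟ p
  ... | no _ = ∧-false (primeDivisor c q)
    where
    ∧-false : ∀ b → b ∧ false ≡ false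
    ∧-false true = refl
    ∧-false false = refl
  ... | yes refl rewrite ⌊⌋-false (q ∣? c) p∤c = ∧-false-true ⌊ prime? q ⌋
    where
    ∧-false-true : ∀ b → (b ∧ false) ∧ true ≡ false
    ∧-false-true true = refl
    ∧-false-true false = refl

  ω-mul-prime : ∀ {p c} → Prime p → ¬ p ∣ c → 1 ≤ c → ω (p * c) ≡ suc (ω c)
  ω-mul-prime {p} {c} pp p∤c c≥1 = begin
    ω (p * c)                                   ≡⟨ length-filterB-upTo (primeDivisor (p * c)) (suc (p * c)) ⟩
    count (suc (p * c)) (primeDivisor (p * c))  ≡⟨ count-cong (suc (p * c)) (λ q _ → primeDivisor-mul q pp p∤c) ⟩
    count (suc (p * c)) (λ q → primeDivisor c q ∨ ⌊ q ≟ p ⌋)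
      ≡⟨ count-∨ (suc (p * c)) (primeDivisor c) _ (λ q → primeDivisor-disjoint q p∤c) ⟩
    count (suc (p * c)) (primeDivisor c) + count (suc (p * c)) (λ q → ⌊ q ≟ p ⌋)
      ≡⟨ cong₂ _+_ (count-extend (suc (p * c)) (primeDivisor c) (s≤s c≤pc) beyond-c)
                   (count-point (suc (p * c)) (s≤s (m≤m*n p c {{>-nonZero c≥1}}))) ⟩
    count (suc c) (primeDivisor c) + 1          ≡⟨ +-comm _ 1 ⟩
    suc (count (suc c) (primeDivisor c))        ≡⟨ cong suc (length-filterB-upTo (primeDivisor c) (suc c)) ⟨
    suc (ω c) ∎
    where
    c≤pc : c ≤ p * c
    c≤pc = m≤n*m c p {{>-nonZero (≤-trans (s≤s z≤n) (prime≥2 pp))}}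
    beyond-c : ∀ j → suc c ≤ j → j < suc (p * c) → primeDivisor c j ≡ false
    beyond-c j c<j _ rewrite ⌊⌋-false (j ∣? c) (λ j∣c → <-irrefl refl (≤-trans c<j (∣⇒≤ {{>-nonZero c≥1}} j∣c)))
      = ∧-false ⌊ prime? j ⌋
      where
      ∧-false : ∀ b → b ∧ false ≡ false
      ∧-false true = refl
      ∧-false false = refl

  negM : MuVal → MuVal
  negM μzero = μzero
  negM μone = μminus
  negM μminus = μone

  parityVal-suc : ∀ w → parityVal (suc w) ≡ negM (parityVal w)
  parityVal-suc zero = refl
  parityVal-suc (suc zero) = refl
  parityVal-suc (suc (suc w)) = parityVal-suc w

  mul-prime≥1 : ∀ {p c} → Prime p → 1 ≤ c → 1 ≤ p * c
  mul-prime≥1 {p} {c} pp c≥1 = ≤-trans c≥1 (m≤n*m c p {{>-nonZero (≤-trans (s≤s z≤n) (prime≥2 pp))}})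

  squarefreeB-mul-coprime : ∀ {p c} → Prime p → ¬ p ∣ c → 1 ≤ c → squarefreeB (p * c) ≡ squarefreeB c
  squarefreeB-mul-coprime {p} {c} pp p∤c c≥1 = bool-⇔ (squarefreeB (p * c)) (squarefreeB c)
    (λ h → squarefreeB-complete (squarefree-divisor (n∣m*n p) (squarefreeB-sound (mul-prime≥1 pp c≥1) h)))
    (λ h → squarefreeB-complete (squarefree-mul-prime pp p∤c (squarefreeB-sound c≥1 h)))

  μ-mul-coprime : ∀ {p c} → Prime p → ¬ p ∣ c → 1 ≤ c → μ (p * c) ≡ negM (μ c)
  μ-mul-coprime {p} {c} pp p∤c c≥1
    rewrite squarefreeB-mul-coprime pp p∤c c≥1 | ω-mul-prime pp p∤c c≥1
    with squarefreeB c
  ... | true = parityVal-suc (ω c)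
  ... | false = refl

  μ-mul-dvd : ∀ {p c} → Prime p → p ∣ c → 1 ≤ c → μ (p * c) ≡ μzero
  μ-mul-dvd {p} {c} pp p∣c c≥1 with squarefreeB (p * c) in sf
  ... | false = refl
  ... | true = ⊥-elim (not-squarefree pp p∣c (squarefreeB-sound (mul-prime≥1 pp c≥1) sf))

module PolynomialCongruences where
  open import Data.Nat as ℕ using (ℕ; zero; suc; _+_)
  open import Data.Nat.Divisibility using (_∣_; _∣?_; ∣-refl; ∣-trans)
  open import Data.Nat.LCM using (m∣lcm[m,n]; n∣lcm[m,n]; lcm-least)
  open import Data.Integer as ℤ using (ℤ; +_; ∣_∣)
  open import Data.Integer.Properties using (+-identityˡ; *-zeroʳ)
  open import Data.Integer.Tactic.RingSolver using (solve-∀)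
  import Data.Integer.Divisibility.Signed as Signed
  open import Data.Bool using (Bool; _∧_)
  open import Data.Fin using (Fin)
  import Data.Fin as Fin
  open import Data.Product using (∃; _,_)
  open import Data.List using ([]; _∷_)
  open import Relation.Nullary.Decidable using (⌊_⌋)
  open import Relation.Binary.PropositionalEquality

  eval-shift : ∀ g x L → ∃ λ t → eval g (+ (x + L)) ≡ eval g (+ x) ℤ.+ + L ℤ.* t
  eval-shift [] x L = + 0 , sym (trans (+-identityˡ _) (*-zeroʳ (+ L)))
  eval-shift (a ∷ g) x L with eval-shift g x L
  ... | t , eq = + x ℤ.* t ℤ.+ (eval g (+ x) ℤ.+ + L ℤ.* t) ,
    trans (cong (λ e → a ℤ.+ (+ x ℤ.+ + L) ℤ.* e) eq) (horner a (+ x) (+ L) (eval g (+ x)) t)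
    where
    horner : ∀ a x L e t → a ℤ.+ (x ℤ.+ L) ℤ.* (e ℤ.+ L ℤ.* t)
                          ≡ (a ℤ.+ x ℤ.* e) ℤ.+ L ℤ.* (x ℤ.* t ℤ.+ (e ℤ.+ L ℤ.* t))
    horner = solve-∀

  ∣?-shift : ∀ {d L} A t → d ∣ L → ⌊ d ∣? ∣ A ℤ.+ + L ℤ.* t ∣ ⌋ ≡ ⌊ d ∣? ∣ A ∣ ⌋
  ∣?-shift {d} {L} A t d∣L = ⌊⌋-⇔ (d ∣? _) (d ∣? _)
    (λ h → Signed.∣⇒∣ᵤ {+ d} {A} (Signed.∣m+n∣n⇒∣m (Signed.∣ᵤ⇒∣ {+ d} {A ℤ.+ + L ℤ.* t} h) d∣Lt))
    (λ h → Signed.∣⇒∣ᵤ {+ d} {A ℤ.+ + L ℤ.* t} (Signed.∣m∣n⇒∣m+n (Signed.∣ᵤ⇒∣ {+ d} {A} h) d∣Lt))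
    where
    d∣Lt : (+ d) Signed.∣ (+ L ℤ.* t)
    d∣Lt = Signed.∣m⇒∣m*n t (Signed.∣ᵤ⇒∣ {+ d} {+ L} d∣L)

  lcmF-∣ : ∀ r (d : Fin r → ℕ) i → d i ∣ lcmF r d
  lcmF-∣ (suc r) d Fin.zero = m∣lcm[m,n] (d Fin.zero) _
  lcmF-∣ (suc r) d (Fin.suc i) = ∣-trans (lcmF-∣ r (λ j → d (Fin.suc j)) i) (n∣lcm[m,n] (d Fin.zero) _)

  lcmF-mono : ∀ r (d m : Fin r → ℕ) → (∀ i → d i ∣ m i) → lcmF r d ∣ lcmF r m
  lcmF-mono zero d m _ = ∣-refl
  lcmF-mono (suc r) d m d∣m =
    lcm-least (∣-trans (d∣m Fin.zero) (m∣lcm[m,n] (m Fin.zero) _))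
              (∣-trans (lcmF-mono r _ _ (λ i → d∣m (Fin.suc i))) (n∣lcm[m,n] (m Fin.zero) _))

  allFinB-cong : ∀ r {b b′ : Fin r → Bool} → (∀ i → b i ≡ b′ i) → allFinB r b ≡ allFinB r b′
  allFinB-cong zero _ = refl
  allFinB-cong (suc r) h = cong₂ _∧_ (h Fin.zero) (allFinB-cong r (λ i → h (Fin.suc i)))

  solves : ∀ r → (Fin r → Poly) → (Fin r → ℕ) → ℕ → Bool
  solves r g d x = allFinB r (λ i → ⌊ d i ∣? ∣ eval (g i) (+ x) ∣ ⌋)

  solves-periodic : ∀ r g d → Periodic (solves r g d) (lcmF r d)
  solves-periodic r g d x = allFinB-cong r λ i → shift i (eval-shift (g i) x (lcmF r d))
    where
    shift : ∀ i → (∃ λ t → eval (g i) (+ (x + lcmF r d)) ≡ eval (g i) (+ x) ℤ.+ + lcmF r d ℤ.* t) →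
            ⌊ d i ∣? ∣ eval (g i) (+ (x + lcmF r d)) ∣ ⌋ ≡ ⌊ d i ∣? ∣ eval (g i) (+ x) ∣ ⌋
    shift i (t , eq) rewrite eq = ∣?-shift (eval (g i) (+ x)) t (lcmF-∣ r d i)

open MoebiusStep using (negM; μ-mul-coprime; μ-mul-dvd; prime-coprime; prime-factor)
open PolynomialCongruences using (solves; solves-periodic; lcmF-mono)

module Sums {c ℓ : Level} (R : CommutativeRing c ℓ) where
  open import Data.Nat as ℕ using (ℕ; zero; suc; _≤_; _<_; z≤n; s≤s; _≟_; >-nonZero)
  open import Data.Nat.Properties as ℕ using (≤-refl; ≤-trans; ≤-pred; m≤n⇒m≤1+n; m≤n⇒m<n∨m≡n; <-irrefl; +-suc)
  open import Data.Nat.Divisibility using (_∣_; _∣?_; ∣⇒≤; m∣m*n; ∣m∣n⇒∣m+n; ∣m+n∣m⇒∣n; ∣-refl)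
  open import Data.Bool using (Bool; true; false; _∧_; if_then_else_)
  open import Data.Sum using (inj₁; inj₂)
  open import Relation.Nullary using (¬_)
  open import Relation.Nullary.Decidable using (⌊_⌋)
  open import Relation.Binary.PropositionalEquality as ≡ using (_≡_)

  open CommutativeRing R
  open InRing R
  open import Algebra.Properties.CommutativeSemigroup +-commutativeSemigroup using (interchange)
  open SetoidReasoning setoid

  ≡⇒≈ : ∀ {x y} → x ≡ y → x ≈ y
  ≡⇒≈ ≡.refl = refl

  Σ₁ : ℕ → (ℕ → Carrier) → Carrier
  Σ₁ zero F = 0#
  Σ₁ (suc n) F = Σ₁ n F + F (suc n)

  ind : Bool → Carrier → Carrier
  ind b x = if b then x else 0#

  Σ₁-cong-range : ∀ n {F G : ℕ → Carrier} → (∀ j → 1 ≤ j → j ≤ n → F j ≈ G j) → Σ₁ n F ≈ Σ₁ n G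
  Σ₁-cong-range zero _ = refl
  Σ₁-cong-range (suc n) h = +-cong (Σ₁-cong-range n (λ j 1≤j j≤n → h j 1≤j (m≤n⇒m≤1+n j≤n))) (h (suc n) (s≤s z≤n) ≤-refl)

  Σ₁-cong : ∀ n {F G : ℕ → Carrier} → (∀ j → F j ≈ G j) → Σ₁ n F ≈ Σ₁ n G
  Σ₁-cong n h = Σ₁-cong-range n (λ j _ _ → h j)

  Σ₁-zero : ∀ n {F : ℕ → Carrier} → (∀ j → 1 ≤ j → j ≤ n → F j ≈ 0#) → Σ₁ n F ≈ 0#
  Σ₁-zero n {F} h = begin
    Σ₁ n F          ≈⟨ Σ₁-cong-range n h ⟩
    Σ₁ n (λ _ → 0#) ≈⟨ zeros n ⟩
    0# ∎
    where
    zeros : ∀ n → Σ₁ n (λ _ → 0#) ≈ 0#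
    zeros zero = refl
    zeros (suc n) = trans (+-identityʳ _) (zeros n)

  Σ₁-+ : ∀ n (F G : ℕ → Carrier) → Σ₁ n (λ j → F j + G j) ≈ Σ₁ n F + Σ₁ n G
  Σ₁-+ zero F G = sym (+-identityˡ 0#)
  Σ₁-+ (suc n) F G = trans (+-congʳ (Σ₁-+ n F G)) (interchange (Σ₁ n F) (Σ₁ n G) (F (suc n)) (G (suc n)))

  Σ₁-*ʳ : ∀ n x (F : ℕ → Carrier) → Σ₁ n F * x ≈ Σ₁ n (λ j → F j * x)
  Σ₁-*ʳ zero x F = zeroˡ x
  Σ₁-*ʳ (suc n) x F = trans (distribʳ x (Σ₁ n F) (F (suc n))) (+-congʳ (Σ₁-*ʳ n x F))

  Σ₁-split : ∀ a b (F : ℕ → Carrier) → Σ₁ (a ℕ.+ b) F ≈ Σ₁ a F + Σ₁ b (λ j → F (a ℕ.+ j))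
  Σ₁-split a zero F rewrite ℕ.+-identityʳ a = sym (+-identityʳ (Σ₁ a F))
  Σ₁-split a (suc b) F rewrite +-suc a b = trans (+-congʳ (Σ₁-split a b F)) (+-assoc _ _ _)

  Σ₁-extend : ∀ {n} N (F : ℕ → Carrier) → n ≤ N → (∀ j → n < j → j ≤ N → F j ≈ 0#) → Σ₁ N F ≈ Σ₁ n F
  Σ₁-extend zero F z≤n _ = refl
  Σ₁-extend (suc N) F n≤1+N h with m≤n⇒m<n∨m≡n n≤1+N
  ... | inj₂ ≡.refl = refl
  ... | inj₁ n<1+N = trans (+-congˡ (h (suc N) n<1+N ≤-refl))
      (trans (+-identityʳ _) (Σ₁-extend N F (≤-pred n<1+N) (λ j n<j j≤N → h j n<j (m≤n⇒m≤1+n j≤N))))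

  Σ₁-swap : ∀ a b (F : ℕ → ℕ → Carrier) → Σ₁ a (λ i → Σ₁ b (F i)) ≈ Σ₁ b (λ j → Σ₁ a (λ i → F i j))
  Σ₁-swap zero b F = sym (Σ₁-zero b (λ _ _ _ → refl))
  Σ₁-swap (suc a) b F = trans (+-congʳ (Σ₁-swap a b F)) (sym (Σ₁-+ b (λ j → Σ₁ a (λ i → F i j)) (F (suc a))))

  ind-cong : ∀ b {x y} → x ≈ y → ind b x ≈ ind b y
  ind-cong true x≈y = x≈y
  ind-cong false _ = refl

  ind-0 : ∀ b → ind b 0# ≈ 0#
  ind-0 true = refl
  ind-0 false = refl

  ind-false : ∀ {b} x → b ≡ false → ind b x ≈ 0#
  ind-false x ≡.refl = refl

  ind-Σ₁ : ∀ b n (F : ℕ → Carrier) → ind b (Σ₁ n F) ≈ Σ₁ n (λ j → ind b (F j))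
  ind-Σ₁ true n F = refl
  ind-Σ₁ false n F = sym (Σ₁-zero n (λ _ _ _ → refl))

  ind-*ʳ : ∀ b x y → ind b x * y ≈ ind b (x * y)
  ind-*ʳ true x y = refl
  ind-*ʳ false x y = zeroˡ y

  ind-*ˡ : ∀ b x y → x * ind b y ≈ ind b (x * y)
  ind-*ˡ true x y = refl
  ind-*ˡ false x y = zeroʳ x

  ind-∧ : ∀ a b x → ind a (ind b x) ≈ ind (a ∧ b) x
  ind-∧ true b x = refl
  ind-∧ false b x = refl

  ind-comm : ∀ a b x → ind a (ind b x) ≈ ind b (ind a x)
  ind-comm true b x = refl
  ind-comm false true x = refl
  ind-comm false false x = refl

  Σ₁-point : ∀ n g (F : ℕ → Carrier) → 1 ≤ g → g ≤ n → Σ₁ n (λ j → ind ⌊ j ≟ g ⌋ (F j)) ≈ F g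
  Σ₁-point n g@(suc g′) F _ g≤n = begin
    Σ₁ n G                 ≈⟨ Σ₁-extend n G g≤n (λ j g<j _ → off j (λ j≡g → <-irrefl (≡.sym j≡g) g<j)) ⟩
    Σ₁ g′ G + G g          ≈⟨ +-cong (Σ₁-zero g′ (λ j _ j≤g′ → off j (λ j≡g → <-irrefl j≡g (s≤s j≤g′))))
                                     (≡⇒≈ (≡.cong (λ b → ind b (F g)) (⌊⌋-true (g ≟ g) ≡.refl))) ⟩
    0# + F g               ≈⟨ +-identityˡ (F g) ⟩
    F g ∎
    where
    G = λ j → ind ⌊ j ≟ g ⌋ (F j)
    off : ∀ j → ¬ j ≡ g → G j ≈ 0#
    off j j≢g = ind-false (F j) (⌊⌋-false (j ≟ g) j≢g)

  Σ₁-multiples : ∀ e K (G : ℕ → Carrier) → 1 ≤ e →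
    Σ₁ (e ℕ.* K) (λ d → ind ⌊ e ∣? d ⌋ (G d)) ≈ Σ₁ K (λ c → G (e ℕ.* c))
  Σ₁-multiples e zero G _ rewrite ℕ.*-zeroʳ e = refl
  Σ₁-multiples e@(suc e′) (suc K) G e≥1 = begin
    Σ₁ (e ℕ.* suc K) H                         ≡⟨ ≡.cong (λ n → Σ₁ n H) eK+e ⟩
    Σ₁ (e ℕ.* K ℕ.+ e) H                       ≈⟨ Σ₁-split (e ℕ.* K) e H ⟩
    Σ₁ (e ℕ.* K) H + Σ₁ e (λ j → H (e ℕ.* K ℕ.+ j)) ≈⟨ +-cong (Σ₁-multiples e K G e≥1) last-block ⟩
    Σ₁ K (λ c → G (e ℕ.* c)) + G (e ℕ.* K ℕ.+ e) ≡⟨ ≡.cong (λ n → Σ₁ K (λ c → G (e ℕ.* c)) + G n) (≡.sym eK+e) ⟩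
    Σ₁ (suc K) (λ c → G (e ℕ.* c)) ∎
    where
    H = λ d → ind ⌊ e ∣? d ⌋ (G d)
    eK+e : e ℕ.* suc K ≡ e ℕ.* K ℕ.+ e
    eK+e = ≡.trans (ℕ.*-suc e K) (ℕ.+-comm e (e ℕ.* K))
    not-multiple : ∀ j → 1 ≤ j → j < e → ¬ e ∣ e ℕ.* K ℕ.+ j
    not-multiple j 1≤j j<e e∣ = <-irrefl ≡.refl (≤-trans j<e (∣⇒≤ {{>-nonZero 1≤j}} (∣m+n∣m⇒∣n e∣ (m∣m*n K))))
    -- among e·K+1, …, e·K+e only the last one is a multiple of e
    last-block : Σ₁ e (λ j → H (e ℕ.* K ℕ.+ j)) ≈ G (e ℕ.* K ℕ.+ e)
    last-block = begin
      Σ₁ e′ (λ j → H (e ℕ.* K ℕ.+ j)) + H (e ℕ.* K ℕ.+ e)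
        ≈⟨ +-congʳ (Σ₁-zero e′ (λ j 1≤j j≤e′ → ind-false _ (⌊⌋-false (e ∣? e ℕ.* K ℕ.+ j) (not-multiple j 1≤j (s≤s j≤e′))))) ⟩
      0# + H (e ℕ.* K ℕ.+ e)
        ≈⟨ +-identityˡ _ ⟩
      H (e ℕ.* K ℕ.+ e)
        ≡⟨ ≡.cong (λ b → ind b (G (e ℕ.* K ℕ.+ e))) (⌊⌋-true (e ∣? e ℕ.* K ℕ.+ e) (∣m∣n⇒∣m+n (m∣m*n K) ∣-refl)) ⟩
      G (e ℕ.* K ℕ.+ e) ∎

  natR-+ : ∀ a b → natR (a ℕ.+ b) ≈ natR a + natR b
  natR-+ zero b = sym (+-identityˡ _)
  natR-+ (suc a) b = trans (+-congˡ (natR-+ a b)) (sym (+-assoc _ _ _))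

  ind-bit : ∀ b x → ind b x ≈ x * natR (bit b)
  ind-bit true x = sym (trans (*-congˡ (+-identityʳ 1#)) (*-identityʳ x))
  ind-bit false x = sym (zeroʳ x)

  Σ₁-count : ∀ n (B : ℕ → Bool) x → Σ₁ n (λ k → ind (B k) x) ≈ x * natR (count n (λ j → B (suc j)))
  Σ₁-count zero B x = sym (zeroʳ x)
  Σ₁-count (suc n) B x = begin
    Σ₁ n (λ k → ind (B k) x) + ind (B (suc n)) x
      ≈⟨ +-cong (Σ₁-count n B x) (ind-bit (B (suc n)) x) ⟩
    x * natR (count n B′) + x * natR (bit (B (suc n)))
      ≈⟨ distribˡ x _ _ ⟨
    x * (natR (count n B′) + natR (bit (B (suc n))))
      ≈⟨ *-congˡ (natR-+ (count n B′) _) ⟨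
    x * natR (count (suc n) B′) ∎
    where B′ = λ j → B (suc j)

module DivisorSums {c ℓ : Level} (R : CommutativeRing c ℓ) where
  open import Data.Nat as ℕ using (ℕ; zero; suc; _≤_; >-nonZero)
  open import Data.Nat.Properties using (≤-trans; <-irrefl)
  open import Data.Nat.Divisibility using (_∣_; _∣?_; ∣⇒≤)
  open import Data.Bool using (Bool; true; false)
  open import Data.List using (List; []; _∷_; _++_; map; upTo)
  open import Data.List.Properties using (upTo-∷ʳ; map-++; map-∘)
  import Data.Fin as Fin
  import Data.Vec.Functional as VF
  open import Relation.Nullary using (yes; no)
  open import Relation.Binary.PropositionalEquality as ≡ using (_≡_)

  open CommutativeRing R
  open InRing R
  open Sums R
  open SetoidReasoning setoid

  sumL-++ : ∀ xs ys → sumL (xs ++ ys) ≈ sumL xs + sumL ys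
  sumL-++ [] ys = sym (+-identityˡ _)
  sumL-++ (x ∷ xs) ys = trans (+-congˡ (sumL-++ xs ys)) (sym (+-assoc _ _ _))

  sumFrom1-Σ₁ : ∀ n (F : ℕ → Carrier) → sumFrom1 n F ≈ Σ₁ n F
  sumFrom1-Σ₁ zero F = refl
  sumFrom1-Σ₁ (suc n) F = begin
    sumL (map F′ (upTo (suc n)))         ≡⟨ ≡.cong (λ xs → sumL (map F′ xs)) (≡.sym (upTo-∷ʳ n)) ⟩
    sumL (map F′ (upTo n ++ n ∷ []))      ≡⟨ ≡.cong sumL (map-++ F′ (upTo n) (n ∷ [])) ⟩
    sumL (map F′ (upTo n) ++ F′ n ∷ [])   ≈⟨ sumL-++ (map F′ (upTo n)) (F′ n ∷ []) ⟩
    sumFrom1 n F + (F (suc n) + 0#)       ≈⟨ +-cong (sumFrom1-Σ₁ n F) (+-identityʳ _) ⟩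
    Σ₁ n F + F (suc n) ∎
    where F′ = λ j → F (suc j)

  sumL-filterB : ∀ {A : Set} (P : A → Bool) (F : A → Carrier) xs →
                 sumL (map F (filterB P xs)) ≈ sumL (map (λ x → ind (P x) (F x)) xs)
  sumL-filterB P F [] = refl
  sumL-filterB P F (x ∷ xs) with P x
  ... | true = +-congˡ (sumL-filterB P F xs)
  ... | false = trans (sumL-filterB P F xs) (sym (+-identityˡ _))

  sumL-cong : ∀ {A : Set} {F G : A → Carrier} xs → (∀ x → F x ≈ G x) → sumL (map F xs) ≈ sumL (map G xs)
  sumL-cong [] _ = refl
  sumL-cong (x ∷ xs) h = +-cong (h x) (sumL-cong xs h)

  sumL-*ˡ : ∀ {A : Set} y (F : A → Carrier) xs → y * sumL (map F xs) ≈ sumL (map (λ x → y * F x) xs)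
  sumL-*ˡ y F [] = zeroʳ y
  sumL-*ˡ y F (x ∷ xs) = trans (distribˡ y _ _) (+-congˡ (sumL-*ˡ y F xs))

  sumL-*ʳ : ∀ {A : Set} y (F : A → Carrier) xs → sumL (map F xs) * y ≈ sumL (map (λ x → F x * y) xs)
  sumL-*ʳ y F [] = zeroˡ y
  sumL-*ʳ y F (x ∷ xs) = trans (distribʳ y _ _) (+-congˡ (sumL-*ʳ y F xs))

  Σ₁-sumL : ∀ {A : Set} n (F : ℕ → A → Carrier) xs →
            Σ₁ n (λ k → sumL (map (F k) xs)) ≈ sumL (map (λ x → Σ₁ n (λ k → F k x)) xs)
  Σ₁-sumL n F [] = Σ₁-zero n (λ _ _ _ → refl)
  Σ₁-sumL n F (x ∷ xs) = trans (Σ₁-+ n _ _) (+-congˡ (Σ₁-sumL n F xs))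

  divisors : ℕ → List ℕ
  divisors n = filterB (λ d → ⌊ d ∣? n ⌋) (map suc (upTo n))

  sumDiv-Σ₁ : ∀ n (F : ℕ → Carrier) → sumDiv n F ≈ Σ₁ n (λ d → ind ⌊ d ∣? n ⌋ (F d))
  sumDiv-Σ₁ n F = begin
    sumDiv n F                                                ≈⟨ sumL-filterB (λ d → ⌊ d ∣? n ⌋) F (map suc (upTo n)) ⟩
    sumL (map (λ d → ind ⌊ d ∣? n ⌋ (F d)) (map suc (upTo n))) ≡⟨ ≡.cong sumL (≡.sym (map-∘ (upTo n))) ⟩
    sumFrom1 n (λ d → ind ⌊ d ∣? n ⌋ (F d))                   ≈⟨ sumFrom1-Σ₁ n _ ⟩
    Σ₁ n (λ d → ind ⌊ d ∣? n ⌋ (F d)) ∎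

  divisors-extend : ∀ {n} N (F : ℕ → Carrier) → 1 ≤ n → n ≤ N →
    Σ₁ N (λ d → ind ⌊ d ∣? n ⌋ (F d)) ≈ Σ₁ n (λ d → ind ⌊ d ∣? n ⌋ (F d))
  divisors-extend {n} N F n≥1 n≤N = Σ₁-extend N _ n≤N λ d n<d _ →
    ind-false (F d) (⌊⌋-false (d ∣? n) (λ d∣n → <-irrefl ≡.refl (≤-trans n<d (∣⇒≤ {{>-nonZero n≥1}} d∣n))))

  sumDiv-cong : ∀ n {F G : ℕ → Carrier} → (∀ d → F d ≈ G d) → sumDiv n F ≈ sumDiv n G
  sumDiv-cong n = sumL-cong (divisors n)

  sumDiv-cong-∣ : ∀ n {F G : ℕ → Carrier} → (∀ d → d ∣ n → F d ≈ G d) → sumDiv n F ≈ sumDiv n G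
  sumDiv-cong-∣ n {F} {G} h = begin
    sumDiv n F                          ≈⟨ sumDiv-Σ₁ n F ⟩
    Σ₁ n (λ d → ind ⌊ d ∣? n ⌋ (F d))   ≈⟨ Σ₁-cong n on-divisors ⟩
    Σ₁ n (λ d → ind ⌊ d ∣? n ⌋ (G d))   ≈⟨ sumDiv-Σ₁ n G ⟨
    sumDiv n G ∎
    where
    on-divisors : ∀ d → ind ⌊ d ∣? n ⌋ (F d) ≈ ind ⌊ d ∣? n ⌋ (G d)
    on-divisors d with d ∣? n
    ... | yes d∣n = h d d∣n
    ... | no _ = refl

  sumDivTuples-cong : ∀ r m {F G : (Fin r → ℕ) → Carrier} →
    (∀ d → (∀ i → d i ∣ m i) → F d ≈ G d) → sumDivTuples r m F ≈ sumDivTuples r m G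
  sumDivTuples-cong zero m h = h (λ ()) (λ ())
  sumDivTuples-cong (suc r) m h = sumDiv-cong-∣ (m Fin.zero) λ d d∣m₀ →
    sumDivTuples-cong r (VF.tail m) λ ds ds∣ → h (d VF.∷ ds) λ { Fin.zero → d∣m₀ ; (Fin.suc i) → ds∣ i }

  sumDivTuples-*ˡ : ∀ r m y (F : (Fin r → ℕ) → Carrier) →
    y * sumDivTuples r m F ≈ sumDivTuples r m (λ d → y * F d)
  sumDivTuples-*ˡ zero m y F = refl
  sumDivTuples-*ˡ (suc r) m y F =
    trans (sumL-*ˡ y _ (divisors (m Fin.zero))) (sumDiv-cong (m Fin.zero) (λ d → sumDivTuples-*ˡ r (VF.tail m) y _))

  Σ₁-sumDivTuples : ∀ r m n (F : ℕ → (Fin r → ℕ) → Carrier) →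
    Σ₁ n (λ k → sumDivTuples r m (F k)) ≈ sumDivTuples r m (λ d → Σ₁ n (λ k → F k d))
  Σ₁-sumDivTuples zero m n F = refl
  Σ₁-sumDivTuples (suc r) m n F =
    trans (Σ₁-sumL n _ (divisors (m Fin.zero))) (sumDiv-cong (m Fin.zero) (λ d → Σ₁-sumDivTuples r (VF.tail m) n _))

  prodF-cong : ∀ r {a b : Fin r → Carrier} → (∀ i → a i ≈ b i) → prodF r a ≈ prodF r b
  prodF-cong zero _ = refl
  prodF-cong (suc r) h = *-cong (h Fin.zero) (prodF-cong r (λ i → h (Fin.suc i)))

  prodF-sumDiv : ∀ r m (H : Fin r → ℕ → Carrier) →
    prodF r (λ i → sumDiv (m i) (H i)) ≈ sumDivTuples r m (λ d → prodF r (λ i → H i (d i)))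
  prodF-sumDiv zero m H = refl
  prodF-sumDiv (suc r) m H = begin
    sumDiv (m Fin.zero) H₀ * prodF r (λ i → sumDiv (m (Fin.suc i)) (H (Fin.suc i)))
      ≈⟨ *-congˡ (prodF-sumDiv r (VF.tail m) (λ i → H (Fin.suc i))) ⟩
    sumDiv (m Fin.zero) H₀ * rest
      ≈⟨ sumL-*ʳ rest H₀ (divisors (m Fin.zero)) ⟩
    sumDiv (m Fin.zero) (λ d → H₀ d * rest)
      ≈⟨ sumDiv-cong (m Fin.zero) (λ d → sumDivTuples-*ˡ r (VF.tail m) (H₀ d) _) ⟩
    sumDivTuples (suc r) m (λ d → prodF (suc r) (λ i → H i (d i))) ∎
    where
    H₀ = H Fin.zero
    rest = sumDivTuples r (VF.tail m) (λ ds → prodF r (λ i → H (Fin.suc i) (ds i)))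

  prodF-ind : ∀ r (b : Fin r → Bool) (x : Fin r → Carrier) →
    prodF r (λ i → ind (b i) (x i)) ≈ ind (allFinB r b) (prodF r x)
  prodF-ind zero b x = refl
  prodF-ind (suc r) b x with b Fin.zero
  ... | true = trans (*-congˡ (prodF-ind r (λ i → b (Fin.suc i)) (λ i → x (Fin.suc i))))
                     (ind-*ˡ (allFinB r (λ i → b (Fin.suc i))) (x Fin.zero) _)
  ... | false = zeroˡ _

module MoebiusInversion {c ℓ : Level} (R : CommutativeRing c ℓ) where
  open import Data.Nat as ℕ using (ℕ; zero; suc; _≤_; _<_; z≤n; s≤s; _≟_; >-nonZero)
  open import Data.Nat.Properties as ℕ using (≤-refl; ≤-trans; <-irrefl)
  open import Data.Nat.Divisibility
  open import Data.Nat.DivMod using (m*n/n≡m)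
  open import Data.Nat.GCD using (gcd; gcd[m,n]∣m; gcd[m,n]∣n; gcd-greatest)
  open import Data.Nat.Coprimality using (coprime-divisor)
  open import Data.Nat.Primality using (Prime)
  open import Data.Bool using (true; false; not; _∧_)
  open import Data.Product using (_,_)
  open import Data.Empty using (⊥-elim)
  open import Relation.Nullary using (yes; no)
  open import Relation.Nullary.Decidable using (⌊_⌋)
  open import Relation.Binary.PropositionalEquality as ≡ using (_≡_)

  open CommutativeRing R
  open InRing R
  open Sums R
  open DivisorSums R
  open import Algebra.Properties.Ring ring using (-‿involutive; -0#≈0#)
  open SetoidReasoning setoid

  val : MuVal → Carrier
  val μzero = 0#
  val μone = 1#
  val μminus = - 1#

  μR-val : ∀ n → μR n ≡ val (μ n)
  μR-val n with μ n
  ... | μzero = ≡.refl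
  ... | μone = ≡.refl
  ... | μminus = ≡.refl

  val-negM : ∀ v → val (negM v) ≈ - val v
  val-negM μzero = sym -0#≈0#
  val-negM μone = refl
  val-negM μminus = sym (-‿involutive 1#)

  ind-neg : ∀ b x → ind b (- x) ≈ - ind b x
  ind-neg true x = refl
  ind-neg false x = sym -0#≈0#

  ind-split : ∀ b x → x ≈ ind (not b) x + ind b x
  ind-split true x = sym (+-identityˡ x)
  ind-split false x = sym (+-identityʳ x)

  μR-mul-prime : ∀ {p c} → Prime p → 1 ≤ c → μR (p ℕ.* c) ≈ - ind (not ⌊ p ∣? c ⌋) (μR c)
  μR-mul-prime {p} {c} pp c≥1 rewrite μR-val (p ℕ.* c) | μR-val c with p ∣? c
  ... | yes p∣c rewrite μ-mul-dvd pp p∣c c≥1 = sym -0#≈0#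
  ... | no p∤c rewrite μ-mul-coprime pp p∤c c≥1 = val-negM (μ c)

  -- The divisors of p·K split into those coprime to p, which are the
  -- divisors d of K with p ∤ d, and the multiples p·c with c ∣ K; by
  -- μR-mul-prime the two parts cancel.
  μ-divisor-sum-prime-multiple : ∀ {p} K → Prime p → 1 ≤ K →
    Σ₁ (p ℕ.* K) (λ d → ind ⌊ d ∣? p ℕ.* K ⌋ (μR d)) ≈ 0#
  μ-divisor-sum-prime-multiple {p} K pp K≥1 = begin
    Σ₁ n (λ d → ind (D d) (μR d))
      ≈⟨ Σ₁-cong n (λ d → ind-split (Q d) (ind (D d) (μR d))) ⟩
    Σ₁ n (λ d → ind (not (Q d)) (ind (D d) (μR d)) + ind (Q d) (ind (D d) (μR d)))
      ≈⟨ Σ₁-+ n _ _ ⟩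
    Σ₁ n (λ d → ind (not (Q d)) (ind (D d) (μR d))) + Σ₁ n (λ d → ind (Q d) (ind (D d) (μR d)))
      ≈⟨ +-cong coprime-part multiple-part ⟩
    Σ₁ K A + Σ₁ K (λ c → - A c)
      ≈⟨ Σ₁-+ K A (λ c → - A c) ⟨
    Σ₁ K (λ c → A c + - A c)
      ≈⟨ Σ₁-zero K (λ c _ _ → -‿inverseʳ (A c)) ⟩
    0# ∎
    where
    n = p ℕ.* K
    D = λ d → ⌊ d ∣? n ⌋
    Q = λ d → ⌊ p ∣? d ⌋
    A = λ d → ind ⌊ d ∣? K ⌋ (ind (not (Q d)) (μR d))
    p≥1 : 1 ≤ p
    p≥1 = ≤-trans (s≤s z≤n) (MoebiusStep.prime≥2 pp)
    coprime-term : ∀ d → ind (not (Q d)) (ind (D d) (μR d)) ≈ A d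
    coprime-term d with p ∣? d
    ... | yes _ = sym (ind-0 ⌊ d ∣? K ⌋)
    ... | no p∤d = ≡⇒≈ (≡.cong (λ b → ind b (μR d))
            (⌊⌋-⇔ (d ∣? n) (d ∣? K) (coprime-divisor (prime-coprime pp p∤d)) (∣n⇒∣m*n p)))
    coprime-part : Σ₁ n (λ d → ind (not (Q d)) (ind (D d) (μR d))) ≈ Σ₁ K A
    coprime-part = trans (Σ₁-cong n coprime-term) (divisors-extend n _ K≥1 (ℕ.m≤n*m K p {{>-nonZero p≥1}}))
    multiple-term : ∀ c → 1 ≤ c → c ≤ K → ind (D (p ℕ.* c)) (μR (p ℕ.* c)) ≈ - A c
    multiple-term c c≥1 _ = begin
      ind (D (p ℕ.* c)) (μR (p ℕ.* c))
        ≡⟨ ≡.cong (λ b → ind b (μR (p ℕ.* c)))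
             (⌊⌋-⇔ (p ℕ.* c ∣? n) (c ∣? K) (*-cancelˡ-∣ p {{>-nonZero p≥1}}) (*-pres-∣ (∣-refl {p}))) ⟩
      ind ⌊ c ∣? K ⌋ (μR (p ℕ.* c))
        ≈⟨ ind-cong ⌊ c ∣? K ⌋ (μR-mul-prime pp c≥1) ⟩
      ind ⌊ c ∣? K ⌋ (- ind (not (Q c)) (μR c))
        ≈⟨ ind-neg ⌊ c ∣? K ⌋ _ ⟩
      - A c ∎
    multiple-part : Σ₁ n (λ d → ind (Q d) (ind (D d) (μR d))) ≈ Σ₁ K (λ c → - A c)
    multiple-part = trans (Σ₁-multiples p K (λ d → ind (D d) (μR d)) p≥1) (Σ₁-cong-range K multiple-term)

  μ-divisor-sum : ∀ n → 1 ≤ n → Σ₁ n (λ d → ind ⌊ d ∣? n ⌋ (μR d)) ≈ ind ⌊ n ≟ 1 ⌋ 1#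
  μ-divisor-sum (suc zero) _ = +-identityˡ 1#
  μ-divisor-sum n@(suc (suc _)) _ with prime-factor n (s≤s (s≤s z≤n))
  ... | p , pp , p∣n =
    ≡.subst (λ k → Σ₁ k (λ d → ind ⌊ d ∣? k ⌋ (μR d)) ≈ 0#) (≡.sym (m∣n⇒n≡m*quotient p∣n))
            (μ-divisor-sum-prime-multiple (quotient p∣n) pp (ℕ.>-nonZero⁻¹ _ {{quotient≢0 p∣n}}))

  divisor-≥1 : ∀ {d n} → d ∣ n → 1 ≤ n → 1 ≤ d
  divisor-≥1 {zero} 0∣n n≥1 = ⊥-elim (<-irrefl (≡.sym (0∣⇒≡0 0∣n)) n≥1)
  divisor-≥1 {suc _} _ _ = s≤s z≤n

  -- Σ_{e=1}^{g} [e·c ∣ g] μ(e) = [c = g]: the e with e·c ∣ g are the divisors of g/c.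
  cofactor-sum : ∀ {g c} → 1 ≤ g → 1 ≤ c → Σ₁ g (λ e → ind ⌊ e ℕ.* c ∣? g ⌋ (μR e)) ≈ ind ⌊ c ≟ g ⌋ 1#
  cofactor-sum {g} {c} g≥1 c≥1 with c ∣? g
  ... | no c∤g = trans (Σ₁-zero g (λ e _ _ → ind-false _ (⌊⌋-false (e ℕ.* c ∣? g) (λ ec∣g → c∤g (m*n∣⇒n∣ e c ec∣g)))))
                       (sym (ind-false 1# (⌊⌋-false (c ≟ g) (λ { ≡.refl → c∤g ∣-refl }))))
  ... | yes c∣g = begin
    Σ₁ g (λ e → ind ⌊ e ℕ.* c ∣? g ⌋ (μR e))
      ≈⟨ Σ₁-cong g (λ e → ≡⇒≈ (≡.cong (λ b → ind b (μR e)) (⌊⌋-⇔ (e ℕ.* c ∣? g) (e ∣? q) cancel-c (restore-c e)))) ⟩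
    Σ₁ g (λ e → ind ⌊ e ∣? q ⌋ (μR e))
      ≈⟨ divisors-extend g μR q≥1 (∣⇒≤ {{>-nonZero g≥1}} (quotient-∣ c∣g)) ⟩
    Σ₁ q (λ e → ind ⌊ e ∣? q ⌋ (μR e))
      ≈⟨ μ-divisor-sum q q≥1 ⟩
    ind ⌊ q ≟ 1 ⌋ 1#
      ≡⟨ ≡.cong (λ b → ind b 1#) (⌊⌋-⇔ (q ≟ 1) (c ≟ g) q≡1⇒c≡g c≡g⇒q≡1) ⟩
    ind ⌊ c ≟ g ⌋ 1# ∎
    where
    q = quotient c∣g
    g≡qc : g ≡ q ℕ.* c
    g≡qc = m∣n⇒n≡quotient*m c∣g
    q≥1 : 1 ≤ q
    q≥1 = divisor-≥1 (quotient-∣ c∣g) g≥1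
    cancel-c : ∀ {e} → e ℕ.* c ∣ g → e ∣ q
    cancel-c {e} ec∣g = *-cancelʳ-∣ c {{>-nonZero c≥1}} (≡.subst (e ℕ.* c ∣_) g≡qc ec∣g)
    restore-c : ∀ e → e ∣ q → e ℕ.* c ∣ g
    restore-c e e∣q = ≡.subst (e ℕ.* c ∣_) (≡.sym g≡qc) (*-pres-∣ e∣q (∣-refl {c}))
    q≡1⇒c≡g : q ≡ 1 → c ≡ g
    q≡1⇒c≡g ≡.refl = ≡.sym (≡.trans g≡qc (ℕ.*-identityˡ c))
    c≡g⇒q≡1 : c ≡ g → q ≡ 1
    c≡g⇒q≡1 c≡g = ℕ.*-cancelʳ-≡ q 1 c {{>-nonZero c≥1}}
                    (≡.trans (≡.sym g≡qc) (≡.trans (≡.sym c≡g) (≡.sym (ℕ.*-identityˡ c))))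

  divisor-pairs : ∀ {e} g (X : ℕ → Carrier) → 1 ≤ e → 1 ≤ g →
    Σ₁ g (λ d → ind ⌊ d ∣? g ⌋ (ind ⌊ e ∣? d ⌋ (X d))) ≈ Σ₁ g (λ c → ind ⌊ e ℕ.* c ∣? g ⌋ (X (e ℕ.* c)))
  divisor-pairs {e} g X e≥1 g≥1 = begin
    Σ₁ g (λ d → ind ⌊ d ∣? g ⌋ (ind ⌊ e ∣? d ⌋ (X d)))
      ≈⟨ Σ₁-cong g (λ d → ind-comm ⌊ d ∣? g ⌋ ⌊ e ∣? d ⌋ (X d)) ⟩
    Σ₁ g (λ d → ind ⌊ e ∣? d ⌋ (H d))
      ≈⟨ Σ₁-extend (e ℕ.* g) _ (ℕ.m≤n*m g e {{>-nonZero e≥1}}) beyond-g ⟨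
    Σ₁ (e ℕ.* g) (λ d → ind ⌊ e ∣? d ⌋ (H d))
      ≈⟨ Σ₁-multiples e g H e≥1 ⟩
    Σ₁ g (λ c → H (e ℕ.* c)) ∎
    where
    H = λ d → ind ⌊ d ∣? g ⌋ (X d)
    beyond-g : ∀ d → g < d → d ≤ e ℕ.* g → ind ⌊ e ∣? d ⌋ (H d) ≈ 0#
    beyond-g d g<d _ = trans (ind-cong ⌊ e ∣? d ⌋ (ind-false (X d) (⌊⌋-false (d ∣? g)
                          (λ d∣g → <-irrefl ≡.refl (≤-trans g<d (∣⇒≤ {{>-nonZero g≥1}} d∣g))))))
                             (ind-0 ⌊ e ∣? d ⌋)

  μconv-Σ₁ : ∀ (f : ℕ → Carrier) {d} g → 1 ≤ d → d ≤ g →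
    μconv f d ≈ Σ₁ g (λ e → ind ⌊ e ∣? d ⌋ (μR e * f (quot d e)))
  μconv-Σ₁ f {d} g d≥1 d≤g = trans (sumDiv-Σ₁ d _) (sym (divisors-extend g _ d≥1 d≤g))

  quot-mul : ∀ {e} c → 1 ≤ e → quot (e ℕ.* c) e ≡ c
  quot-mul {suc e} c _ = ≡.trans (≡.cong (ℕ._/ suc e) (ℕ.*-comm (suc e) c)) (m*n/n≡m c (suc e))

  moebius-inversion : ∀ g (f : ℕ → Carrier) → 1 ≤ g → sumDiv g (μconv f) ≈ f g
  moebius-inversion g f g≥1 = begin
    sumDiv g (μconv f)
      ≈⟨ sumDiv-Σ₁ g (μconv f) ⟩
    Σ₁ g (λ d → ind (Dg d) (μconv f d))
      ≈⟨ Σ₁-cong-range g (λ d d≥1 d≤g → ind-cong (Dg d) (μconv-Σ₁ f g d≥1 d≤g)) ⟩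
    Σ₁ g (λ d → ind (Dg d) (Σ₁ g (λ e → ind ⌊ e ∣? d ⌋ (X d e))))
      ≈⟨ Σ₁-cong g (λ d → ind-Σ₁ (Dg d) g _) ⟩
    Σ₁ g (λ d → Σ₁ g (λ e → ind (Dg d) (ind ⌊ e ∣? d ⌋ (X d e))))
      ≈⟨ Σ₁-swap g g _ ⟩
    Σ₁ g (λ e → Σ₁ g (λ d → ind (Dg d) (ind ⌊ e ∣? d ⌋ (X d e))))
      ≈⟨ Σ₁-cong-range g (λ e e≥1 _ → divisor-pairs g (λ d → X d e) e≥1 g≥1) ⟩
    Σ₁ g (λ e → Σ₁ g (λ c → ind ⌊ e ℕ.* c ∣? g ⌋ (X (e ℕ.* c) e)))
      ≈⟨ Σ₁-cong-range g (λ e e≥1 _ → Σ₁-cong g (λ c →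
           ind-cong ⌊ e ℕ.* c ∣? g ⌋ (*-congˡ (≡⇒≈ (≡.cong f (quot-mul c e≥1)))))) ⟩
    Σ₁ g (λ e → Σ₁ g (λ c → ind ⌊ e ℕ.* c ∣? g ⌋ (μR e * f c)))
      ≈⟨ Σ₁-swap g g _ ⟩
    Σ₁ g (λ c → Σ₁ g (λ e → ind ⌊ e ℕ.* c ∣? g ⌋ (μR e * f c)))
      ≈⟨ Σ₁-cong-range g (λ c c≥1 _ → cofactor-term c c≥1) ⟩
    Σ₁ g (λ c → ind ⌊ c ≟ g ⌋ (f c))
      ≈⟨ Σ₁-point g g f g≥1 ≤-refl ⟩
    f g ∎
    where
    Dg = λ d → ⌊ d ∣? g ⌋
    X = λ d e → μR e * f (quot d e)
    cofactor-term : ∀ c → 1 ≤ c → Σ₁ g (λ e → ind ⌊ e ℕ.* c ∣? g ⌋ (μR e * f c)) ≈ ind ⌊ c ≟ g ⌋ (f c)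
    cofactor-term c c≥1 = begin
      Σ₁ g (λ e → ind ⌊ e ℕ.* c ∣? g ⌋ (μR e * f c)) ≈⟨ Σ₁-cong g (λ e → ind-*ʳ ⌊ e ℕ.* c ∣? g ⌋ (μR e) (f c)) ⟨
      Σ₁ g (λ e → ind ⌊ e ℕ.* c ∣? g ⌋ (μR e) * f c) ≈⟨ Σ₁-*ʳ g (f c) _ ⟨
      Σ₁ g (λ e → ind ⌊ e ℕ.* c ∣? g ⌋ (μR e)) * f c ≈⟨ *-congʳ (cofactor-sum g≥1 c≥1) ⟩
      ind ⌊ c ≟ g ⌋ 1# * f c                        ≈⟨ ind-*ʳ ⌊ c ≟ g ⌋ 1# (f c) ⟩
      ind ⌊ c ≟ g ⌋ (1# * f c)                      ≈⟨ ind-cong ⌊ c ≟ g ⌋ (*-identityˡ (f c)) ⟩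
      ind ⌊ c ≟ g ⌋ (f c) ∎

  ∣-gcd : ∀ d a m → ⌊ d ∣? m ⌋ ∧ ⌊ d ∣? a ⌋ ≡ ⌊ d ∣? gcd a m ⌋
  ∣-gcd d a m with d ∣? m | d ∣? a
  ... | yes d∣m | yes d∣a = ≡.sym (⌊⌋-true (d ∣? gcd a m) (gcd-greatest d∣a d∣m))
  ... | yes _ | no d∤a = ≡.sym (⌊⌋-false (d ∣? gcd a m) (λ d∣G → d∤a (∣-trans d∣G (gcd[m,n]∣m a m))))
  ... | no d∤m | _ = ≡.sym (⌊⌋-false (d ∣? gcd a m) (λ d∣G → d∤m (∣-trans d∣G (gcd[m,n]∣n a m))))

  gcd-expansion : ∀ a m (f : ℕ → Carrier) → 1 ≤ m → f (gcd a m) ≈ sumDiv m (λ d → ind ⌊ d ∣? a ⌋ (μconv f d))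
  gcd-expansion a m f m≥1 = sym (begin
    sumDiv m (λ d → ind ⌊ d ∣? a ⌋ (μconv f d))
      ≈⟨ sumDiv-Σ₁ m _ ⟩
    Σ₁ m (λ d → ind ⌊ d ∣? m ⌋ (ind ⌊ d ∣? a ⌋ (μconv f d)))
      ≈⟨ Σ₁-cong m (λ d → trans (ind-∧ ⌊ d ∣? m ⌋ _ _) (≡⇒≈ (≡.cong (λ b → ind b (μconv f d)) (∣-gcd d a m)))) ⟩
    Σ₁ m (λ d → ind ⌊ d ∣? G ⌋ (μconv f d))
      ≈⟨ divisors-extend m (μconv f) G≥1 (∣⇒≤ {{>-nonZero m≥1}} (gcd[m,n]∣n a m)) ⟩
    Σ₁ G (λ d → ind ⌊ d ∣? G ⌋ (μconv f d))
      ≈⟨ sumDiv-Σ₁ G (μconv f) ⟨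
    sumDiv G (μconv f)
      ≈⟨ moebius-inversion G f G≥1 ⟩
    f G ∎)
    where
    G = gcd a m
    G≥1 : 1 ≤ G
    G≥1 = divisor-≥1 (gcd[m,n]∣n a m) m≥1

module CongruenceSums {c ℓ : Level} (R : CommutativeRing c ℓ) where
  open import Data.Nat as ℕ using (ℕ; suc; _≤_)
  open import Relation.Binary.PropositionalEquality as ≡ using (_≡_)

  open CommutativeRing R
  open InRing R
  open Sums R
  open SetoidReasoning setoid

  solution-sum : ∀ r g d x M → 1 ≤ M → lcmF r d ∣ M →
    Σ₁ M (λ k → ind (solves r g d k) x) ≈ x * natR (quot M (lcmF r d) ℕ.* NG r g d)
  solution-sum r g d x M M≥1 L∣M = begin
    Σ₁ M (λ k → ind (solves r g d k) x)                ≈⟨ Σ₁-count M (solves r g d) x ⟩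
    x * natR (count M (λ j → solves r g d (suc j)))    ≡⟨ ≡.cong (λ n → x * natR n) solution-count ⟩
    x * natR (quot M L ℕ.* NG r g d) ∎
    where
    L = lcmF r d
    solution-count : count M (λ j → solves r g d (suc j)) ≡ quot M L ℕ.* NG r g d
    solution-count = ≡.trans (count-from-1-periodic M L (solves r g d) M≥1 L∣M (solves-periodic r g d))
                             (≡.cong (quot M L ℕ.*_) (≡.sym (length-filterB-upTo (solves r g d) L)))

theorem1 : {c ℓ : Level} (R : CommutativeRing c ℓ) →
    let open CommutativeRing R in
    let open InRing R in
    (r : ℕ) → 1 ≤ r → (m : Fin r → ℕ) → (∀ i → 1 ≤ m i) →
    (M : ℕ) → 1 ≤ M → lcmF r m ∣ M →
    (f : Fin r → ℕ → Carrier) → (g : Fin r → Poly) →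
    sumFrom1 M (λ k → prodF r (λ i → f i (gcd ∣ eval (g i) (+ k) ∣ (m i))))
      ≈ sumDivTuples r m (λ d →
          prodF r (λ i → μconv (f i) (d i))
            * natR (quot M (lcmF r d) N.* NG r g d))
theorem1 R r _ m m≥1 M M≥1 lcm∣M f g = begin
    sumFrom1 M (λ k → prodF r (λ i → f i (gcd (a i k) (m i))))
      ≈⟨ sumFrom1-Σ₁ M _ ⟩
    Σ₁ M (λ k → prodF r (λ i → f i (gcd (a i k) (m i))))
      ≈⟨ Σ₁-cong M (λ k → prodF-cong r (λ i → gcd-expansion (a i k) (m i) (f i) (m≥1 i))) ⟩
    Σ₁ M (λ k → prodF r (λ i → sumDiv (m i) (λ d → ind ⌊ d ∣? a i k ⌋ (μconv (f i) d))))
      ≈⟨ Σ₁-cong M (λ k → prodF-sumDiv r m (λ i d → ind ⌊ d ∣? a i k ⌋ (μconv (f i) d))) ⟩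
    Σ₁ M (λ k → sumDivTuples r m (λ d → prodF r (λ i → ind ⌊ d i ∣? a i k ⌋ (μconv (f i) (d i)))))
      ≈⟨ Σ₁-cong M (λ k → sumDivTuples-cong r m (λ d _ → prodF-ind r _ _)) ⟩
    Σ₁ M (λ k → sumDivTuples r m (λ d → ind (solves r g d k) (P d)))
      ≈⟨ Σ₁-sumDivTuples r m M _ ⟩
    sumDivTuples r m (λ d → Σ₁ M (λ k → ind (solves r g d k) (P d)))
      ≈⟨ sumDivTuples-cong r m (λ d d∣m → solution-sum r g d (P d) M M≥1 (∣-trans (lcmF-mono r d m d∣m) lcm∣M)) ⟩
    sumDivTuples r m (λ d → P d * natR (quot M (lcmF r d) N.* NG r g d)) ∎
  where
  open CommutativeRing R
  open InRing R
  open Sums R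
  open DivisorSums R
  open MoebiusInversion R using (gcd-expansion)
  open CongruenceSums R using (solution-sum)
  open SetoidReasoning setoid
  a : Fin r → ℕ → ℕ
  a i k = ∣ eval (g i) (+ k) ∣
  P : (Fin r → ℕ) → Carrier
  P d = prodF r (λ i → μconv (f i) (d i))
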